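{- Let $G$ be a finite simple graph and let $\{G_1,\dots,G_b\}$ be an edge decomposition of $G$ (i.e. the $G_i$ are subgraphs of $G$ whose edge sets partition $E(G)$). Suppose that for each $i=1,\dots,b$, the simple graph $G_i$ has a triangle decomposition and $\Delta_0(G_i)\neq\emptyset$. Then $\Delta_0(G)\neq\emptyset$.
   Context: A triangle decomposition of a (multi)graph is a multiset of triangles (3-cycles) in it such that every edge is contained in a number of these triangles equal to its multiplicity (for a simple graph: every edge lies in exactly one triangle). For a finite simple graph $G$ and a nonnegative integer $a$, $\Gamma_a(G)$ denotes the set of all multigraphs on $V(G)$ obtained by assigning to the edges of $G$ the multiplicities $a,a+1,\dots,a+|E(G)|-1$ bijectively (in some arrangement; multiplicity $0$ is allowed, and non-edges of $G$ have multiplicity $0$). $\Delta_a(G)$ denotes the set of those multigraphs in $\Gamma_a(G)$ that admit a triangle decomposition. -}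

module Defs where

open import Data.Nat using (ℕ; zero; suc; _+_; _<_)
open import Data.Fin using (Fin; toℕ) renaming (zero to fzero; suc to fsuc)
open import Data.Fin.Properties using () renaming (_≟_ to _≟F_)
open import Data.Fin.Permutation using (Permutation′; _⟨$⟩ʳ_)
open import Data.Product using (Σ; _×_; _,_; proj₁; proj₂)
open import Data.Product.Properties using (≡-dec)
open import Data.List using (List; []; _∷_; length; map; concat)
open import Data.Nat.ListAction using (sum)
open import Data.List.Relation.Unary.All using (All)
open import Data.List.Relation.Unary.Unique.Propositional using (Unique)
open import Data.List.Relation.Binary.Permutation.Propositional using (_↭_)
open import Relation.Nullary using (Dec; yes; no; ¬_)
open import Relation.Binary.PropositionalEquality using (_≡_)

-- An (undirected) edge on vertex set Fin n, stored canonically as (u , v) with u < v.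
Edge : ℕ → Set
Edge n = Fin n × Fin n

_≟E_ : ∀ {n} (e f : Edge n) → Dec (e ≡ f)
_≟E_ = ≡-dec _≟F_ _≟F_

IsEdge : ∀ {n} → Edge n → Set
IsEdge (u , v) = toℕ u < toℕ v

record Graph (n : ℕ) : Set where
  field
    edges   : List (Edge n)
    ordered : All IsEdge edges
    unique  : Unique edges
open Graph public

Multigraph : ℕ → Set
Multigraph n = Edge n → ℕ

assign : ∀ {n} (es : List (Edge n)) → (Fin (length es) → ℕ) → Multigraph n
assign []        w e = 0
assign (f ∷ es) w e with f ≟E e
... | yes _ = w fzero + assign es (λ i → w (fsuc i)) e
... | no  _ = assign es (λ i → w (fsuc i)) e

-- Triangles, canonically as (x , y , z) with x < y < z.
Triangle : ℕ → Set
Triangle n = Fin n × Fin n × Fin n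

IsTriangle : ∀ {n} → Triangle n → Set
IsTriangle (x , y , z) = IsEdge (x , y) × IsEdge (y , z)

triEdges : ∀ {n} → Triangle n → List (Edge n)
triEdges (x , y , z) = (x , y) ∷ (x , z) ∷ (y , z) ∷ []

occ : ∀ {n} → Edge n → List (Edge n) → ℕ
occ e []       = 0
occ e (f ∷ fs) with e ≟E f
... | yes _ = suc (occ e fs)
... | no  _ = occ e fs

cover : ∀ {n} → Edge n → List (Triangle n) → ℕ
cover e T = sum (map (λ t → occ e (triEdges t)) T)

TriangleDecomposition : ∀ {n} → Multigraph n → Set
TriangleDecomposition {n} M =
  Σ (List (Triangle n)) λ T →
    All IsTriangle T × (∀ (e : Edge n) → IsEdge e → cover e T ≡ M e)

asMultigraph : ∀ {n} → Graph n → Multigraph n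
asMultigraph G = assign (edges G) (λ _ → 1)

-- The members of Γ_a(G): multiplicities a, a+1, …, a+|E(G)|-1 assigned bijectively.
Γ-member : ∀ {n} (a : ℕ) (G : Graph n) → Permutation′ (length (edges G)) → Multigraph n
Γ-member a G σ = assign (edges G) (λ i → a + toℕ (σ ⟨$⟩ʳ i))

ΔNonempty : ∀ {n} (a : ℕ) → Graph n → Set
ΔNonempty a G =
  Σ (Permutation′ (length (edges G))) λ σ → TriangleDecomposition (Γ-member a G σ)

IsEdgeDecomposition : ∀ {n} → Graph n → List (Graph n) → Set
IsEdgeDecomposition G Gs = concat (map edges Gs) ↭ edges G

{-# OPTIONS --safe #-}

-- Number the edges of the parts consecutively: if the edges of G₁ receive the labels
-- k, k+1, …, k+|E(G₁)|-1, where k = |E(G₂)| + ⋯ + |E(G_b)|, then G₁ carries the sum of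
-- k·G₁ and a member of Δ₀(G₁), both of which are triangle decomposable. Since sums
-- of triangle-decomposable multigraphs are triangle decomposable, induction on b
-- shows that the resulting member of Γ₀(G) lies in Δ₀(G).

module Submission where

open import Defs
open import Data.Nat using (ℕ; zero; suc; _+_; _*_)
open import Data.Nat.Properties
  using (+-assoc; +-commutativeSemigroup; *-distribˡ-+; *-zeroʳ; *-identityʳ; +-identityʳ)
open import Data.Nat.ListAction using (sum)
open import Data.Nat.ListAction.Properties using (sum-++)
open import Algebra.Properties.CommutativeSemigroup +-commutativeSemigroup
  using (interchange; x∙yz≈y∙xz)
open import Data.Fin using (Fin; toℕ; cast; _↑ˡ_; _↑ʳ_) renaming (zero to fzero; suc to fsuc)
open import Data.Fin.Properties
  using (+↔⊎; splitAt-↑ˡ; splitAt-↑ʳ; cast-is-id; toℕ-↑ˡ; toℕ-↑ʳ)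
open import Data.Fin.Permutation using (Permutation; _⟨$⟩ʳ_; _∘ₚ_; lift₀; cast-id; ↔⇒≡)
import Data.Fin.Permutation as Perm
open import Data.List using (List; []; _∷_; _++_; length; map; concat)
open import Data.List.Properties using (length-++; map-++)
open import Data.List.Relation.Unary.All using (All; []; _∷_)
open import Data.List.Relation.Unary.All.Properties using (++⁺)
open import Data.List.Relation.Binary.Permutation.Propositional using (_↭_)
import Data.List.Relation.Binary.Permutation.Propositional as ↭
open import Data.List.Relation.Binary.Permutation.Propositional.Properties using (++-comm)
open import Data.Product using (_×_; _,_; ∃₂)
open import Data.Sum.Function.Propositional using (_⊎-↔_)
open import Function.Properties.Inverse using (↔-sym; ↔-trans)
open import Relation.Nullary using (yes; no)
open import Relation.Binary.PropositionalEquality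
  using (_≡_; _≗_; refl; sym; trans; cong; cong₂; module ≡-Reasoning)

private
  variable
    n m₁ m₂ n₁ n₂ : ℕ

cover-++ : (e : Edge n) (T U : List (Triangle n)) → cover e (T ++ U) ≡ cover e T + cover e U
cover-++ e T U = trans (cong sum (map-++ _ T U)) (sum-++ (map (λ t → occ e (triEdges t)) T) _)

decomposition-resp : {M M′ : Multigraph n} → M ≗ M′ →
  TriangleDecomposition M → TriangleDecomposition M′
decomposition-resp M≗M′ (T , triangles , covers) =
  T , triangles , λ e e-edge → trans (covers e e-edge) (M≗M′ e)

decomposition-+ : {M M′ : Multigraph n} →
  TriangleDecomposition M → TriangleDecomposition M′ → TriangleDecomposition (λ e → M e + M′ e)
decomposition-+ (T , T-triangles , T-covers) (U , U-triangles , U-covers) =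
  T ++ U , ++⁺ T-triangles U-triangles ,
  λ e e-edge → trans (cover-++ e T U) (cong₂ _+_ (T-covers e e-edge) (U-covers e e-edge))

decomposition-* : {M : Multigraph n} (k : ℕ) →
  TriangleDecomposition M → TriangleDecomposition (λ e → k * M e)
decomposition-* zero    _ = [] , [] , λ _ _ → refl
decomposition-* (suc k) d = decomposition-+ d (decomposition-* k d)

assign-cong : (es : List (Edge n)) {u v : Fin (length es) → ℕ} → u ≗ v → assign es u ≗ assign es v
assign-cong []       u≗v e = refl
assign-cong (f ∷ es) u≗v e with f ≟E e
... | yes _ = cong₂ _+_ (u≗v fzero) (assign-cong es (λ i → u≗v (fsuc i)) e)
... | no  _ = assign-cong es (λ i → u≗v (fsuc i)) e

assign-+ : (es : List (Edge n)) (u v : Fin (length es) → ℕ) (e : Edge n) →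
  assign es (λ i → u i + v i) e ≡ assign es u e + assign es v e
assign-+ []       u v e = refl
assign-+ (f ∷ es) u v e with f ≟E e
... | yes _ = trans (cong (u fzero + v fzero +_) (assign-+ es u₁ v₁ e))
                    (interchange (u fzero) (v fzero) (assign es u₁ e) (assign es v₁ e))
  where
  u₁ v₁ : Fin (length es) → ℕ
  u₁ i = u (fsuc i)
  v₁ i = v (fsuc i)
... | no  _ = assign-+ es (λ i → u (fsuc i)) (λ i → v (fsuc i)) e

assign-* : (es : List (Edge n)) (k : ℕ) (w : Fin (length es) → ℕ) (e : Edge n) →
  assign es (λ i → k * w i) e ≡ k * assign es w e
assign-* []       k w e = sym (*-zeroʳ k)
assign-* (f ∷ es) k w e with f ≟E e
... | yes _ = trans (cong (k * w fzero +_) (assign-* es k _ e)) (sym (*-distribˡ-+ k _ _))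
... | no  _ = assign-* es k _ e

assign-shift : (es : List (Edge n)) (k : ℕ) (w : Fin (length es) → ℕ) (e : Edge n) →
  assign es (λ i → k + w i) e ≡ k * assign es (λ _ → 1) e + assign es w e
assign-shift es k w e = begin
  assign es (λ i → k + w i) e                ≡⟨ assign-cong es (λ i → cong (_+ w i) (sym (*-identityʳ k))) e ⟩
  assign es (λ i → k * 1 + w i) e            ≡⟨ assign-+ es (λ _ → k * 1) w e ⟩
  assign es (λ _ → k * 1) e + assign es w e  ≡⟨ cong (_+ assign es w e) (assign-* es k (λ _ → 1) e) ⟩
  k * assign es (λ _ → 1) e + assign es w e  ∎
  where open ≡-Reasoning

assign-++ : (xs ys : List (Edge n)) (w : Fin (length xs + length ys) → ℕ) (e : Edge n) →
  assign (xs ++ ys) (λ i → w (cast (length-++ xs) i)) e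
    ≡ assign xs (λ i → w (i ↑ˡ length ys)) e + assign ys (λ j → w (length xs ↑ʳ j)) e
assign-++ []       ys w e = assign-cong ys (λ j → cong w (cast-is-id _ j)) e
assign-++ (x ∷ xs) ys w e with x ≟E e
... | yes _ = trans (cong (w fzero +_) (assign-++ xs ys w₁ e)) (sym (+-assoc (w fzero) _ _))
  where
  w₁ : Fin (length xs + length ys) → ℕ
  w₁ i = w (fsuc i)
... | no  _ = assign-++ xs ys (λ i → w (fsuc i)) e

positions : {xs ys : List (Edge n)} → xs ↭ ys → Permutation (length ys) (length xs)
positions ↭.refl          = Perm.id
positions (↭.prep _ p)    = lift₀ (positions p)
positions (↭.swap _ _ p)  = Perm.swap (positions p)
positions (↭.trans p q)   = positions q ∘ₚ positions p

assign-∷ : (f : Edge n) (es : List (Edge n)) (w : Fin (suc (length es)) → ℕ) (e : Edge n) →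
  assign (f ∷ es) w e ≡ assign (f ∷ []) (λ _ → w fzero) e + assign es (λ i → w (fsuc i)) e
assign-∷ f es w e with f ≟E e
... | yes _ = cong (_+ assign es (λ i → w (fsuc i)) e) (sym (+-identityʳ (w fzero)))
... | no  _ = refl

assign-↭ : {xs ys : List (Edge n)} (p : xs ↭ ys) (w : Fin (length xs) → ℕ) →
  assign ys (λ i → w (positions p ⟨$⟩ʳ i)) ≗ assign xs w
assign-↭ ↭.refl w e = refl
assign-↭ (↭.prep {xs} {ys} x p) w e = begin
  assign (x ∷ ys) _ e          ≡⟨ assign-∷ x ys _ e ⟩
  X + assign ys _ e            ≡⟨ cong (X +_) (assign-↭ p w₁ e) ⟩
  X + assign xs w₁ e           ≡⟨ assign-∷ x xs w e ⟨
  assign (x ∷ xs) w e          ∎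
  where
  open ≡-Reasoning
  w₁ : Fin (length xs) → ℕ
  w₁ i = w (fsuc i)
  X : ℕ
  X = assign (x ∷ []) (λ _ → w fzero) e
assign-↭ (↭.swap {xs} {ys} x y p) w e = begin
  assign (y ∷ x ∷ ys) _ e      ≡⟨ assign-∷ y (x ∷ ys) _ e ⟩
  Y + assign (x ∷ ys) _ e      ≡⟨ cong (Y +_) (assign-∷ x ys _ e) ⟩
  Y + (X + assign ys _ e)      ≡⟨ cong (λ r → Y + (X + r)) (assign-↭ p w₂ e) ⟩
  Y + (X + assign xs w₂ e)     ≡⟨ x∙yz≈y∙xz Y X _ ⟩
  X + (Y + assign xs w₂ e)     ≡⟨ cong (X +_) (assign-∷ y xs _ e) ⟨
  X + assign (y ∷ xs) _ e      ≡⟨ assign-∷ x (y ∷ xs) w e ⟨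
  assign (x ∷ y ∷ xs) w e      ∎
  where
  open ≡-Reasoning
  w₂ : Fin (length xs) → ℕ
  w₂ i = w (fsuc (fsuc i))
  X Y : ℕ
  X = assign (x ∷ []) (λ _ → w fzero) e
  Y = assign (y ∷ []) (λ _ → w (fsuc fzero)) e
assign-↭ (↭.trans p q) w e = trans (assign-↭ q _ e) (assign-↭ p w e)

_⊕_ : Permutation m₁ n₁ → Permutation m₂ n₂ → Permutation (m₁ + m₂) (n₁ + n₂)
π ⊕ ρ = ↔-trans +↔⊎ (↔-trans (π ⊎-↔ ρ) (↔-sym +↔⊎))

⊕-↑ˡ : (π : Permutation m₁ n₁) (ρ : Permutation m₂ n₂) (i : Fin m₁) →
  (π ⊕ ρ) ⟨$⟩ʳ (i ↑ˡ m₂) ≡ (π ⟨$⟩ʳ i) ↑ˡ n₂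
⊕-↑ˡ {m₁} {m₂ = m₂} π ρ i rewrite splitAt-↑ˡ m₁ i m₂ = refl

⊕-↑ʳ : (π : Permutation m₁ n₁) (ρ : Permutation m₂ n₂) (j : Fin m₂) →
  (π ⊕ ρ) ⟨$⟩ʳ (m₁ ↑ʳ j) ≡ n₁ ↑ʳ (ρ ⟨$⟩ʳ j)
⊕-↑ʳ {m₁} {m₂ = m₂} π ρ j rewrite splitAt-↑ʳ m₁ m₂ j = refl

-- Δ₀ ≠ ∅ for an edge list, with the number k of labels left free (it equals the
-- length by ↔⇒≡), so that lists can be concatenated without casting the labels.
DecomposableLabelling : List (Edge n) → Set
DecomposableLabelling es =
  ∃₂ λ k (π : Permutation (length es) k) → TriangleDecomposition (assign es (λ i → toℕ (π ⟨$⟩ʳ i)))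

labelling-↭ : {xs ys : List (Edge n)} → xs ↭ ys → DecomposableLabelling xs → DecomposableLabelling ys
labelling-↭ p (k , π , d) = k , positions p ∘ₚ π , decomposition-resp (λ e → sym (assign-↭ p _ e)) d

labelling-++ : (xs ys : List (Edge n)) → DecomposableLabelling xs →
  TriangleDecomposition (assign ys (λ _ → 1)) → DecomposableLabelling ys →
  DecomposableLabelling (xs ++ ys)
labelling-++ xs ys (k , π , dπ) dys (l , ρ , dρ) =
  k + l , cast-id (length-++ xs) ∘ₚ (π ⊕ ρ) ,
  decomposition-resp (λ e → sym (splitting e))
    (decomposition-+ dπ (decomposition-+ (decomposition-* k dys) dρ))
  where
  splitting : ∀ e → assign (xs ++ ys) (λ i → toℕ ((π ⊕ ρ) ⟨$⟩ʳ cast (length-++ xs) i)) e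
    ≡ assign xs (λ i → toℕ (π ⟨$⟩ʳ i)) e
      + (k * assign ys (λ _ → 1) e + assign ys (λ j → toℕ (ρ ⟨$⟩ʳ j)) e)
  splitting e = begin
    assign (xs ++ ys) (λ i → toℕ ((π ⊕ ρ) ⟨$⟩ʳ cast (length-++ xs) i)) e
      ≡⟨ assign-++ xs ys (λ i → toℕ ((π ⊕ ρ) ⟨$⟩ʳ i)) e ⟩
    assign xs (λ i → toℕ ((π ⊕ ρ) ⟨$⟩ʳ (i ↑ˡ _))) e
      + assign ys (λ j → toℕ ((π ⊕ ρ) ⟨$⟩ʳ (_ ↑ʳ j))) e
      ≡⟨ cong₂ _+_ (assign-cong xs (λ i → trans (cong toℕ (⊕-↑ˡ π ρ i)) (toℕ-↑ˡ _ l)) e)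
                   (assign-cong ys (λ j → trans (cong toℕ (⊕-↑ʳ π ρ j)) (toℕ-↑ʳ k _)) e) ⟩
    assign xs (λ i → toℕ (π ⟨$⟩ʳ i)) e + assign ys (λ j → k + toℕ (ρ ⟨$⟩ʳ j)) e
      ≡⟨ cong (assign xs _ e +_) (assign-shift ys k _ e) ⟩
    assign xs (λ i → toℕ (π ⟨$⟩ʳ i)) e
      + (k * assign ys (λ _ → 1) e + assign ys (λ j → toℕ (ρ ⟨$⟩ʳ j)) e) ∎
    where open ≡-Reasoning

labelling-concat : (Gs : List (Graph n)) →
  All (λ H → TriangleDecomposition (asMultigraph H) × ΔNonempty 0 H) Gs →
  DecomposableLabelling (concat (map edges Gs))
labelling-concat []       []                       = 0 , Perm.id , [] , [] , λ _ _ → refl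
labelling-concat (H ∷ Gs) ((dH , σ , dσ) ∷ parts) =
  labelling-↭ (++-comm rest (edges H))
    (labelling-++ rest (edges H) (labelling-concat Gs parts) dH (_ , σ , dσ))
  where
  rest : List (Edge _)
  rest = concat (map edges Gs)

mainTheorem3 : ∀ {n : ℕ} (G : Graph n) (Gs : List (Graph n)) →
    IsEdgeDecomposition G Gs →
    All (λ H → TriangleDecomposition (asMultigraph H) × ΔNonempty 0 H) Gs →
    ΔNonempty 0 G
mainTheorem3 G Gs decomposition parts
  with labelling-↭ decomposition (labelling-concat Gs parts)
... | k , π , d with ↔⇒≡ π
...   | refl = π , d
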